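{- Let $G$ be a connected graph with maximum degree $\Delta(G)=3$ and let $k$ be a non-negative integer. Then $t(G)\ge k$ if and only if $G$ has an induced path $P$ such that either (a) every vertex of $P$ has degree $3$ in $G$ and $|E(P)|\ge 2k-2$, or (b) every vertex of $P$ has degree $3$ in $G$ except for one of the two endpoints of $P$, which has degree $2$ in $G$, and $|E(P)|\ge k-1$.
   Context: 2-neighbor bootstrap percolation on a graph $G$: given $S\subseteq V(G)$, set $S_0=S$ and let $S_{i+1}$ be $S_i$ together with all vertices of $G$ having at least two neighbors in $S_i$. $S$ is a percolating set if $S_t=V(G)$ for some $t$; then $t(G,S)$ is the minimum such $t$. The percolation time of $G$ is $t(G)=\max\{t(G,S): S \text{ is a percolating set of } G\}$. -}

module Defs where

open import Data.Nat using (ℕ; zero; suc; _+_; _≤_; _<_; _≤ᵇ_)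
open import Data.Bool using (Bool; true; false; _∧_; _∨_; if_then_else_)
open import Data.Fin using (Fin; zero; suc; toℕ; fromℕ)
open import Data.Product using (Σ; ∃; _×_; _,_)
open import Data.Sum using (_⊎_)
open import Relation.Binary.PropositionalEquality using (_≡_; _≢_)
open import Relation.Nullary using (¬_)
open import Function.Definitions using (Injective)
open import Function.Bundles using (_⇔_)

record Graph : Set where
  field
    n       : ℕ
    adj     : Fin n → Fin n → Bool
    sym     : ∀ u v → adj u v ≡ adj v u
    irrefl  : ∀ v → adj v v ≡ false
open Graph public

countTrue : ∀ {m} → (Fin m → Bool) → ℕ
countTrue {zero}  f = 0
countTrue {suc m} f = (if f zero then 1 else 0) + countTrue (λ i → f (suc i))

VSet : Graph → Set
VSet G = Fin (n G) → Bool

degree : (G : Graph) → Fin (n G) → ℕ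
degree G v = countTrue (adj G v)

MaxDegree3 : Graph → Set
MaxDegree3 G = (∀ v → degree G v ≤ 3) × ∃ λ v → degree G v ≡ 3

data Reach (G : Graph) : Fin (n G) → Fin (n G) → Set where
  here : ∀ {v} → Reach G v v
  step : ∀ {u w v} → adj G u w ≡ true → Reach G w v → Reach G u v

Connected : Graph → Set
Connected G = ∀ u v → Reach G u v

-- 2-neighbour bootstrap percolation
nbrsIn : (G : Graph) → VSet G → Fin (n G) → ℕ
nbrsIn G S v = countTrue (λ w → adj G v w ∧ S w)

bstep : (G : Graph) → VSet G → VSet G
bstep G S v = S v ∨ (2 ≤ᵇ nbrsIn G S v)

iter : (G : Graph) → VSet G → ℕ → VSet G
iter G S zero    = S
iter G S (suc t) = bstep G (iter G S t)

Full : (G : Graph) → VSet G → Set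
Full G S = ∀ v → S v ≡ true

PercTime : (G : Graph) → VSet G → ℕ → Set
PercTime G S t = Full G (iter G S t) × (∀ t' → t' < t → ¬ Full G (iter G S t'))

-- t(G) ≥ k, with t(G) the maximum of t(G,S) over percolating sets S
-- (the maximum exists: finitely many sets, and V(G) itself percolates)
PercTimeAtLeast : Graph → ℕ → Set
PercTimeAtLeast G k = ∃ λ (S : VSet G) → ∃ λ t → PercTime G S t × k ≤ t

IsInducedPath : (G : Graph) (m : ℕ) → (Fin (suc m) → Fin (n G)) → Set
IsInducedPath G m p =
  Injective _≡_ _≡_ p ×
  (∀ i j → (adj G (p i) (p j) ≡ true) ⇔ (suc (toℕ i) ≡ toℕ j ⊎ suc (toℕ j) ≡ toℕ i))

AllDeg3 : (G : Graph) (m : ℕ) → (Fin (suc m) → Fin (n G)) → Set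
AllDeg3 G m p = ∀ i → degree G (p i) ≡ 3

OneEndDeg2 : (G : Graph) (m : ℕ) → (Fin (suc m) → Fin (n G)) → Set
OneEndDeg2 G m p =
  (degree G (p zero) ≡ 2 × (∀ i → i ≢ zero → degree G (p i) ≡ 3)) ⊎
  (degree G (p (fromℕ m)) ≡ 2 × (∀ i → i ≢ fromℕ m → degree G (p i) ≡ 3))

module Submission where

-- Follow an infection backwards: a vertex infected at time i + 1 has a neighbour
-- infected exactly at time i, so a vertex v infected at the final time t is the top of a chain
-- c 0, …, c t = v of vertices infected exactly at their index. With maximum degree 3, a chain
-- vertex c i (0 < i < t) has degree 3 and every neighbour other than c (i + 1) is infected at
-- time i − 1. Joining the chain of v with the chain of a neighbour of v infected late (at time t,
-- or at time t − 1 if v has degree 3) yields an induced path of degree-3 vertices with 2t − 1 or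
-- 2t − 2 edges; if v has degree 2 and no such neighbour, c 1, …, c t is an induced path with
-- t − 1 edges ending at v.
-- Conversely, start from the complement of the path. The infection then runs along the path from
-- an endpoint with two outside neighbours, one vertex per step, and a path vertex stays uninfected
-- as long as every path vertex within the elapsed time of it has a single outside neighbour; the
-- middle vertex in case (a) and the degree-2 end in case (b) are therefore still uninfected at
-- time k − 1.

open import Defs hiding (sym)
open import Data.Bool using (Bool; true; false; _∧_; not; if_then_else_)
open import Data.Bool.Properties using (¬-not; T-≡) renaming (_≟_ to _≟ᵇ_)
open import Data.Empty using (⊥; ⊥-elim)
open import Data.Fin using (Fin; zero; suc; toℕ; fromℕ; fromℕ<; opposite)
open import Data.Fin.Properties
  using (any?; all?; ¬∀⟶∃¬; toℕ-injective; toℕ<n; toℕ-fromℕ; toℕ-fromℕ<; fromℕ<-toℕ; opposite-prop; opposite-involutive)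
  renaming (_≟_ to _≟ᶠ_)
open import Data.List using (List; []; _∷_; length)
open import Data.List.Membership.Propositional using (_∈_; _∉_)
open import Data.List.Relation.Unary.Any using (here; there) renaming (any? to anyᴸ?)
open import Data.List.Relation.Unary.Any.Properties using (¬Any[])
open import Data.List.Relation.Unary.All as All using (All; []; _∷_)
open import Data.List.Relation.Unary.AllPairs using (AllPairs; []; _∷_)
open import Data.Nat
  using (ℕ; zero; suc; pred; >-nonZero; _+_; _*_; _∸_; ∣_-_∣; _≤_; _<_; z≤n; s≤s; _≤?_; _<?_; _≤′_; ≤′-reflexive; ≤′-refl; ≤′-step)
open import Data.Nat.Properties
open import Data.Product using (∃; _×_; _,_; proj₁; proj₂)
open import Data.Sum using (_⊎_; inj₁; inj₂; map₁; map₂; swap)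
open import Function.Bundles using (_⇔_; mk⇔; Equivalence)
open import Relation.Binary.PropositionalEquality
  using (_≡_; refl; sym; trans; cong; subst; subst₂; _≢_; module ≡-Reasoning)
open import Relation.Nullary using (¬_; Dec; yes; no; does)
open import Relation.Nullary.Decidable using (_×-dec_; ¬?; dec-true)

-- Counting

true≢false : ∀ {b} → b ≡ true → b ≢ false
true≢false refl ()

∧-true⁻ : ∀ {a b} → a ∧ b ≡ true → a ≡ true × b ≡ true
∧-true⁻ {true} {true} _ = refl , refl

not-true⁻ : ∀ {b} → not b ≡ true → b ≡ false
not-true⁻ {false} _ = refl

∧-true : ∀ {a b} → a ≡ true → b ≡ true → a ∧ b ≡ true
∧-true refl refl = refl

bit : Bool → ℕ
bit b = if b then 1 else 0

bit≤1 : ∀ b → bit b ≤ 1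
bit≤1 true = ≤-refl
bit≤1 false = z≤n

erase : ∀ {m} → (Fin m → Bool) → Fin m → Fin m → Bool
erase f a w = if does (w ≟ᶠ a) then false else f w

erase-true : ∀ {m} (f : Fin m → Bool) {a w} → w ≢ a → f w ≡ true → erase f a w ≡ true
erase-true f {a} {w} w≢a fw with w ≟ᶠ a
... | yes w≡a = ⊥-elim (w≢a w≡a)
... | no _ = fw

erase-true⁻ : ∀ {m} (f : Fin m → Bool) {a w} → erase f a w ≡ true → f w ≡ true × w ≢ a
erase-true⁻ f {a} {w} e with w ≟ᶠ a
erase-true⁻ f () | yes _
... | no w≢a = e , w≢a

countTrue-cong : ∀ {m} {f g : Fin m → Bool} → (∀ w → f w ≡ g w) → countTrue f ≡ countTrue g
countTrue-cong {zero} _ = refl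
countTrue-cong {suc m} {g = g} f≗g rewrite f≗g zero =
  cong (bit (g zero) +_) (countTrue-cong (λ w → f≗g (suc w)))

countTrue-erase : ∀ {m} (f : Fin m → Bool) a → countTrue f ≡ bit (f a) + countTrue (erase f a)
countTrue-erase {suc m} f zero = cong (bit (f zero) +_) (countTrue-cong {f = λ i → f (suc i)} λ _ → refl)
countTrue-erase {suc m} f (suc a) with countTrue-erase (λ i → f (suc i)) a | f zero
... | eq | true = trans (cong suc eq) (sym (+-suc (bit (f (suc a))) _))
... | eq | false = eq

countTrue-none : ∀ {m} (f : Fin m → Bool) → (∀ w → f w ≢ true) → countTrue f ≡ 0
countTrue-none {zero} f none = refl
countTrue-none {suc m} f none with f zero in eq
... | true = ⊥-elim (none zero eq)
... | false = countTrue-none (λ i → f (suc i)) (λ i → none (suc i))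

countTrue-mono : ∀ {m} {f g : Fin m → Bool} → (∀ w → f w ≡ true → g w ≡ true) → countTrue f ≤ countTrue g
countTrue-mono {zero} f⇒g = z≤n
countTrue-mono {suc m} {f} {g} f⇒g =
  +-mono-≤ (bit-mono (f zero) (g zero) (f⇒g zero)) (countTrue-mono (λ w → f⇒g (suc w)))
  where
  bit-mono : ∀ a b → (a ≡ true → b ≡ true) → bit a ≤ bit b
  bit-mono false b _ = z≤n
  bit-mono true b a⇒b rewrite a⇒b refl = ≤-refl

length≤countTrue : ∀ {m} (f : Fin m → Bool) {xs} →
  AllPairs _≢_ xs → All (λ x → f x ≡ true) xs → length xs ≤ countTrue f
length≤countTrue f {[]} _ _ = z≤n
length≤countTrue f {x ∷ xs} (x≢xs ∷ distinct) (fx ∷ fxs) rewrite countTrue-erase f x | fx =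
  s≤s (length≤countTrue (erase f x) distinct
        (All.map (λ { (x≢y , fy) → erase-true f (λ y≡x → x≢y (sym y≡x)) fy }) (All.zip (x≢xs , fxs))))

countTrue≤length : ∀ {m} (f : Fin m → Bool) xs → (∀ w → f w ≡ true → w ∈ xs) → countTrue f ≤ length xs
countTrue≤length f [] ⊆[] = ≤-reflexive (countTrue-none f (λ w fw → ¬Any[] (⊆[] w fw)))
countTrue≤length f (x ∷ xs) ⊆x∷xs rewrite countTrue-erase f x =
  +-mono-≤ (bit≤1 (f x)) (countTrue≤length (erase f x) xs ⊆xs)
  where
  ⊆xs : ∀ w → erase f x w ≡ true → w ∈ xs
  ⊆xs w e with erase-true⁻ f e
  ... | fw , w≢x with ⊆x∷xs w fw
  ... | here w≡x = ⊥-elim (w≢x w≡x)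
  ... | there w∈xs = w∈xs

fresh-true : ∀ {m} (f : Fin m → Bool) xs → length xs < countTrue f → ∃ λ w → f w ≡ true × w ∉ xs
fresh-true f xs lt with any? (λ w → (f w ≟ᵇ true) ×-dec ¬? (anyᴸ? (w ≟ᶠ_) xs))
... | yes (w , fw , w∉xs) = w , fw , w∉xs
... | no none = ⊥-elim (<⇒≱ lt (countTrue≤length f xs ⊆xs))
  where
  ⊆xs : ∀ w → f w ≡ true → w ∈ xs
  ⊆xs w fw with anyᴸ? (w ≟ᶠ_) xs
  ... | yes w∈xs = w∈xs
  ... | no w∉xs = ⊥-elim (none (w , fw , w∉xs))

countTrue-split : ∀ {m} (f g : Fin m → Bool) →
  countTrue f ≡ countTrue (λ x → f x ∧ g x) + countTrue (λ x → f x ∧ not (g x))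
countTrue-split {zero} f g = refl
countTrue-split {suc m} f g with f zero | g zero | countTrue-split (λ i → f (suc i)) (λ i → g (suc i))
... | true | true | eq = cong suc eq
... | true | false | eq = trans (cong suc eq) (sym (+-suc _ _))
... | false | _ | eq = eq

countTrue-two : ∀ {m} (f : Fin m → Bool) → 2 ≤ countTrue f →
  ∃ λ a → ∃ λ b → a ≢ b × f a ≡ true × f b ≡ true
countTrue-two f 2≤ with fresh-true f [] (≤-trans (s≤s z≤n) 2≤)
... | a , fa , _ with fresh-true f (a ∷ []) 2≤
... | b , fb , b∉[a] = a , b , (λ a≡b → b∉[a] (here (sym a≡b))) , fa , fb

∣n-1+n∣≡1 : ∀ n → ∣ n - suc n ∣ ≡ 1
∣n-1+n∣≡1 zero = refl
∣n-1+n∣≡1 (suc n) = ∣n-1+n∣≡1 n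

2*n∸2≡pred[n]+pred[n] : ∀ n → 2 * n ∸ 2 ≡ pred n + pred n
2*n∸2≡pred[n]+pred[n] zero = refl
2*n∸2≡pred[n]+pred[n] (suc n) = trans (cong (_∸ 1) (+-suc n (n + 0))) (cong (n +_) (+-identityʳ n))

n∸1≡pred[n] : ∀ n → n ∸ 1 ≡ pred n
n∸1≡pred[n] zero = refl
n∸1≡pred[n] (suc n) = refl

suc[m∸a]≡m∸b : ∀ {m a b} → suc b ≡ a → a ≤ m → suc (m ∸ a) ≡ m ∸ b
suc[m∸a]≡m∸b refl a≤m = sym (+-∸-assoc 1 a≤m)

suc[m∸a]≡m∸b⁻ : ∀ {m a b} → a ≤ m → suc (m ∸ a) ≡ m ∸ b → suc b ≡ a
suc[m∸a]≡m∸b⁻ {m} {a} {b} a≤m eq =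
  sym (∸-cancelˡ-≡ a≤m b<m (suc-injective (trans eq (sym (suc[m∸a]≡m∸b refl b<m)))))
  where
  b<m : b < m
  b<m = m∸n≢0⇒n<m (λ m∸b≡0 → 1+n≢0 (trans eq m∸b≡0))

Consecutive : ℕ → ℕ → Set
Consecutive a b = suc a ≡ b ⊎ suc b ≡ a

consecutive-distance : ∀ {a b} → Consecutive a b → ∣ a - b ∣ ≡ 1
consecutive-distance {a} (inj₁ refl) = ∣n-1+n∣≡1 a
consecutive-distance {_} {b} (inj₂ refl) = trans (∣-∣-comm (suc b) b) (∣n-1+n∣≡1 b)

-- Induced paths

opposite-consecutive : ∀ {m} (i j : Fin (suc m)) →
  Consecutive (toℕ (opposite i)) (toℕ (opposite j)) ⇔ Consecutive (toℕ j) (toℕ i)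
opposite-consecutive i j rewrite opposite-prop i | opposite-prop j = mk⇔
  (λ { (inj₁ e) → inj₁ (suc[m∸a]≡m∸b⁻ (bound i) e) ; (inj₂ e) → inj₂ (suc[m∸a]≡m∸b⁻ (bound j) e) })
  (λ { (inj₁ e) → inj₁ (suc[m∸a]≡m∸b e (bound i)) ; (inj₂ e) → inj₂ (suc[m∸a]≡m∸b e (bound j)) })
  where
  bound : ∀ {m} (i : Fin (suc m)) → toℕ i ≤ m
  bound i = ≤-pred (toℕ<n i)

opposite-injective : ∀ {m} {i j : Fin m} → opposite i ≡ opposite j → i ≡ j
opposite-injective {i = i} {j} e = trans (sym (opposite-involutive i)) (trans (cong opposite e) (opposite-involutive j))

reverse-induced : ∀ {G m p} → IsInducedPath G m p → IsInducedPath G m (λ i → p (opposite i))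
reverse-induced (p-injective , p-adjacent) =
  (λ e → opposite-injective (p-injective e)) ,
  λ i j → mk⇔
    (λ a → swap (Equivalence.to (opposite-consecutive i j) (Equivalence.to (p-adjacent (opposite i) (opposite j)) a)))
    (λ c → Equivalence.from (p-adjacent (opposite i) (opposite j)) (Equivalence.from (opposite-consecutive i j) (swap c)))

reverse-first-end : ∀ {G m} {p : Fin (suc m) → Fin (n G)} →
  degree G (p zero) ≡ 2 × (∀ i → i ≢ zero → degree G (p i) ≡ 3) →
  degree G (p (opposite (fromℕ m))) ≡ 2 × (∀ i → i ≢ fromℕ m → degree G (p (opposite i)) ≡ 3)
reverse-first-end {G} {p = p} (start , others) =
  trans (cong (λ i → degree G (p i)) (opposite-involutive zero)) start ,
  λ i i≢end → others (opposite i) (λ e → i≢end (trans (sym (opposite-involutive i)) (cong opposite e)))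

single-vertex-induced : ∀ {G v} → IsInducedPath G 0 (λ _ → v)
single-vertex-induced {G} {v} =
  (λ { {zero} {zero} _ → refl }) ,
  λ { zero zero → mk⇔ (λ v~v → ⊥-elim (true≢false v~v (irrefl G v))) (λ { (inj₁ ()) ; (inj₂ ()) }) }

InducedPathWith : (G : Graph) → (∀ m → (Fin (suc m) → Fin (n G)) → Set) → ℕ → Set
InducedPathWith G P ℓ = ∃ λ m → ∃ λ (p : Fin (suc m) → Fin (n G)) → IsInducedPath G m p × P m p × ℓ ≤ m

LongInducedPath : Graph → ℕ → Set
LongInducedPath G k = ∃ λ m → ∃ λ (p : Fin (suc m) → Fin (n G)) → IsInducedPath G m p ×
  ((AllDeg3 G m p × 2 * k ∸ 2 ≤ m) ⊎ (OneEndDeg2 G m p × k ∸ 1 ≤ m))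

-- Bootstrap percolation

module Percolation (G : Graph) (S : VSet G) where

  V : Set
  V = Fin (n G)

  _~_ : V → V → Set
  u ~ v = adj G u v ≡ true

  ~-sym : ∀ {u v} → u ~ v → v ~ u
  ~-sym {u} {v} u~v = trans (sym (Graph.sym G u v)) u~v

  ~-irrefl : ∀ {v} → ¬ v ~ v
  ~-irrefl {v} v~v = true≢false v~v (irrefl G v)

  Infected Uninfected : ℕ → V → Set
  Infected t v = iter G S t v ≡ true
  Uninfected t v = iter G S t v ≡ false

  infected-suc : ∀ {t v} → Infected t v → Infected (suc t) v
  infected-suc {t} {v} i with iter G S t v
  infected-suc refl | true = refl

  infected-mono : ∀ {s t v} → s ≤ t → Infected s v → Infected t v
  infected-mono {s} {t} {v} s≤t i = go (≤⇒≤′ s≤t)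
    where
    go : ∀ {t} → s ≤′ t → Infected t v
    go ≤′-refl = i
    go {suc t} (≤′-step s≤′t) = infected-suc {t} (go s≤′t)

  uninfected-mono : ∀ {s t v} → s ≤ t → Uninfected t v → Uninfected s v
  uninfected-mono s≤t u = ¬-not (λ i → true≢false (infected-mono s≤t i) u)

  newly-infected⇒2≤nbrs : ∀ {t v} → Uninfected t v → Infected (suc t) v → 2 ≤ nbrsIn G (iter G S t) v
  newly-infected⇒2≤nbrs {t} {v} u i with iter G S t v
  newly-infected⇒2≤nbrs refl i | false = ≤ᵇ⇒≤ 2 _ (Equivalence.from T-≡ i)

  uninfected⇒nbrs≤1 : ∀ {t v} → Uninfected (suc t) v → nbrsIn G (iter G S t) v ≤ 1
  uninfected⇒nbrs≤1 {t} {v} u with 2 ≤? nbrsIn G (iter G S t) v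
  ... | no ≱2 = ≤-pred (≰⇒> ≱2)
  ... | yes 2≤ with iter G S t v
  ... | true = ⊥-elim (true≢false refl u)
  ... | false = ⊥-elim (true≢false (Equivalence.to T-≡ (≤⇒≤ᵇ 2≤)) u)

  infected-by-two : ∀ {t v x y} → x ≢ y → v ~ x → v ~ y → Infected t x → Infected t y → Infected (suc t) v
  infected-by-two {t} {v} x≢y v~x v~y ix iy with iter G S t v
  ... | true = refl
  ... | false = Equivalence.to T-≡ (≤⇒≤ᵇ (length≤countTrue _ ((x≢y ∷ []) ∷ [] ∷ [])
                  (∧-true v~x ix ∷ ∧-true v~y iy ∷ [])))

  stays-uninfected : ∀ {t v} → Uninfected t v → nbrsIn G (iter G S t) v ≤ 1 → Uninfected (suc t) v
  stays-uninfected {t} {v} u ≤1 with iter G S t v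
  stays-uninfected refl ≤1 | false = ¬-not (λ 2≤ → <⇒≱ (s≤s ≤1) (≤ᵇ⇒≤ 2 _ (Equivalence.from T-≡ 2≤)))

  first-full : ∀ T → Full G (iter G S T) → ∃ λ t → PercTime G S t
  first-full zero full = zero , full , λ _ ()
  first-full (suc T) full with all? (λ v → iter G S T v ≟ᵇ true)
  ... | yes full′ = first-full T full′
  ... | no ¬full = suc T , full , λ t′ t′<1+T full′ → ¬full (λ v → infected-mono (≤-pred t′<1+T) (full′ v))

  slow-percolation : ∀ {T} k → Full G (iter G S T) → (∃ λ w → Uninfected (pred k) w) → PercTimeAtLeast G k
  slow-percolation {T} k full late with first-full T full
  ... | t , full-t , early = S , t , (full-t , early) , k≤t k late
    where
    k≤t : ∀ k → (∃ λ w → Uninfected (pred k) w) → k ≤ t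
    k≤t zero _ = z≤n
    k≤t (suc k′) (w , uw) with t ≤? k′
    ... | yes t≤k′ = ⊥-elim (true≢false (infected-mono t≤k′ (full-t w)) uw)
    ... | no t≰k′ = ≰⇒> t≰k′

  BornAt : ℕ → V → Set
  BornAt zero v = Infected 0 v
  BornAt (suc t) v = Infected (suc t) v × Uninfected t v

  born⇒infected : ∀ t {v} → BornAt t v → Infected t v
  born⇒infected zero b = b
  born⇒infected (suc t) b = proj₁ b

  born-first : ∀ s t {v} → Infected s v → BornAt t v → t ≤ s
  born-first s zero _ _ = z≤n
  born-first s (suc t) i (_ , u) with s ≤? t
  ... | yes s≤t = ⊥-elim (true≢false (infected-mono s≤t i) u)
  ... | no s≰t = ≰⇒> s≰t

  born-unique : ∀ s t {v} → BornAt s v → BornAt t v → s ≡ t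
  born-unique s t bs bt =
    ≤-antisym (born-first t s (born⇒infected t bt) bs) (born-first s t (born⇒infected s bs) bt)

  born-predecessor : ∀ t {v} → BornAt (suc t) v → ∃ λ u → v ~ u × BornAt t u
  born-predecessor zero {v} (i , u) with fresh-true _ [] (≤-trans (s≤s z≤n) (newly-infected⇒2≤nbrs {0} u i))
  ... | w , e , _ = w , ∧-true⁻ {adj G v w} e
  born-predecessor (suc t) {v} (i , u)
    with any? (λ w → (adj G v w ≟ᵇ true) ×-dec (iter G S (suc t) w ≟ᵇ true) ×-dec (iter G S t w ≟ᵇ false))
  ... | yes (w , v~w , iw , uw) = w , v~w , iw , uw
  ... | no none =
    ⊥-elim (<⇒≱ (s≤s (uninfected⇒nbrs≤1 {t} u)) (≤-trans (newly-infected⇒2≤nbrs {suc t} u i) (countTrue-mono old)))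
    where
    old : ∀ w → adj G v w ∧ iter G S (suc t) w ≡ true → adj G v w ∧ iter G S t w ≡ true
    old w e with ∧-true⁻ {adj G v w} e | iter G S t w ≟ᵇ true
    ... | v~w , _ | yes iw = ∧-true v~w iw
    ... | v~w , iw | no ¬iw = ⊥-elim (none (w , v~w , iw , ¬-not ¬iw))

  -- y and two neighbours infected at time L already account for all three edges of x.
  birth-next-to-uninfected : ∀ {L x y} → degree G x ≤ 3 → 2 ≤ nbrsIn G (iter G S L) x → x ~ y → Uninfected L y →
    (∀ {z} → x ~ z → z ≡ y ⊎ Infected L z) × degree G x ≡ 3
  birth-next-to-uninfected {L} {x} {y} deg≤3 2≤ x~y uy with countTrue-two _ 2≤
  ... | a , b , a≢b , ea , eb with ∧-true⁻ {adj G x a} ea | ∧-true⁻ {adj G x b} eb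
  ... | x~a , ia | x~b , ib = nbrs , ≤-antisym deg≤3 (length≤countTrue (adj G x) distinct (x~y ∷ x~a ∷ x~b ∷ []))
    where
    y≢a : y ≢ a
    y≢a refl = true≢false ia uy
    y≢b : y ≢ b
    y≢b refl = true≢false ib uy
    distinct : AllPairs _≢_ (y ∷ a ∷ b ∷ [])
    distinct = (y≢a ∷ y≢b ∷ []) ∷ (a≢b ∷ []) ∷ [] ∷ []
    nbrs : ∀ {z} → x ~ z → z ≡ y ⊎ Infected L z
    nbrs {z} x~z with iter G S L z ≟ᵇ true | z ≟ᶠ y
    ... | yes iz | _ = inj₂ iz
    ... | no _ | yes z≡y = inj₁ z≡y
    ... | no ¬iz | no z≢y =
      ⊥-elim (<⇒≱ (s≤s deg≤3)
        (length≤countTrue (adj G x) ((z≢y ∷ z≢a ∷ z≢b ∷ []) ∷ distinct) (x~z ∷ x~y ∷ x~a ∷ x~b ∷ [])))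
      where
      z≢a : z ≢ a
      z≢a refl = ¬iz ia
      z≢b : z ≢ b
      z≢b refl = ¬iz ib

  -- A path along which every vertex q a is still uninfected at its level L a, while all its
  -- neighbours off the path are already infected then, is induced: a chord q a ~ q b would force
  -- each end to be infected at the level of the other.
  levelled-path-induced : ∀ M (q : ℕ → V) (L : ℕ → ℕ) →
    (∀ {a} → a ≤ M → Uninfected (L a) (q a)) →
    (∀ {a b} → a ≤ M → b ≤ M → Consecutive a b → q a ~ q b) →
    (∀ {a z} → a ≤ M → q a ~ z → (∃ λ b → b ≤ M × Consecutive a b × z ≡ q b) ⊎ Infected (L a) z) →
    (∀ {a b} → a ≤ M → b ≤ M → q a ≡ q b → a ≡ b) →
    IsInducedPath G M (λ i → q (toℕ i))
  levelled-path-induced M q L uninfected consecutive nbrs injective =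
    (λ {i} {j} e → toℕ-injective (injective (bound i) (bound j) e)) ,
    (λ i j → mk⇔ (chord-free (bound i) (bound j)) (consecutive (bound i) (bound j)))
    where
    bound : (i : Fin (suc M)) → toℕ i ≤ M
    bound i = ≤-pred (toℕ<n i)
    chord-free : ∀ {a b} → a ≤ M → b ≤ M → q a ~ q b → Consecutive a b
    chord-free {a} {b} a≤M b≤M qa~qb with nbrs a≤M qa~qb | nbrs b≤M (~-sym qa~qb)
    ... | inj₁ (b′ , b′≤M , a⋯b′ , qb≡qb′) | _ = subst (Consecutive a) (injective b′≤M b≤M (sym qb≡qb′)) a⋯b′
    ... | inj₂ _ | inj₁ (a′ , a′≤M , b⋯a′ , qa≡qa′) =
      swap (subst (Consecutive b) (injective a′≤M a≤M (sym qa≡qa′)) b⋯a′)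
    ... | inj₂ iqb | inj₂ iqa with ≤-total (L a) (L b)
    ... | inj₁ La≤Lb = ⊥-elim (true≢false (infected-mono La≤Lb iqb) (uninfected b≤M))
    ... | inj₂ Lb≤La = ⊥-elim (true≢false (infected-mono Lb≤La iqa) (uninfected a≤M))

  record Chain (j : ℕ) (v : V) : Set where
    field
      vertex : ℕ → V
      top    : vertex j ≡ v
      born   : ∀ i → i ≤ j → BornAt i (vertex i)
      link   : ∀ i → i < j → vertex (suc i) ~ vertex i

  extend : (ℕ → V) → ℕ → V → ℕ → V
  extend c j v i with i ≤? j
  ... | yes _ = c i
  ... | no _ = v

  extend-≤ : ∀ c {j} v {i} → i ≤ j → extend c j v i ≡ c i
  extend-≤ c {j} v {i} i≤j with i ≤? j
  ... | yes _ = refl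
  ... | no i≰j = ⊥-elim (i≰j i≤j)

  extend-top : ∀ c j v → extend c j v (suc j) ≡ v
  extend-top c j v with suc j ≤? j
  ... | yes 1+j≤j = ⊥-elim (1+n≰n 1+j≤j)
  ... | no _ = refl

  chain : ∀ j {v} → BornAt j v → Chain j v
  chain zero {v} b = record { vertex = λ _ → v ; top = refl ; born = λ { zero z≤n → b } ; link = λ _ () }
  chain (suc j) {v} b with born-predecessor j b
  ... | u , v~u , bu = record { vertex = extend c j v ; top = extend-top c j v ; born = born′ ; link = link′ }
    where
    open Chain (chain j bu) renaming (vertex to c; top to c-top; born to c-born; link to c-link)
    born′ : ∀ i → i ≤ suc j → BornAt i (extend c j v i)
    born′ i i≤1+j with m≤n⇒m<n∨m≡n i≤1+j
    ... | inj₁ i<1+j = subst (BornAt i) (sym (extend-≤ c v (≤-pred i<1+j))) (c-born i (≤-pred i<1+j))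
    ... | inj₂ refl = subst (BornAt (suc j)) (sym (extend-top c j v)) b
    link′ : ∀ i → i < suc j → extend c j v (suc i) ~ extend c j v i
    link′ i i<1+j with m≤n⇒m<n∨m≡n (≤-pred i<1+j)
    ... | inj₁ i<j = subst₂ _~_ (sym (extend-≤ c v i<j)) (sym (extend-≤ c v (<⇒≤ i<j))) (c-link i i<j)
    ... | inj₂ refl = subst₂ _~_ (sym (extend-top c i v)) (sym (extend-≤ c v ≤-refl)) (subst (v ~_) (sym c-top) v~u)

  chain-interior : (∀ v → degree G v ≤ 3) → ∀ {j v} (C : Chain j v) → let open Chain C in
    ∀ i → suc i < j →
    (∀ {z} → vertex (suc i) ~ z → z ≡ vertex (suc (suc i)) ⊎ Infected i z) × degree G (vertex (suc i)) ≡ 3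
  chain-interior Δ≤3 C i 1+i<j = birth-next-to-uninfected {i} (Δ≤3 _)
    (newly-infected⇒2≤nbrs {i} (proj₂ (born (suc i) (<⇒≤ 1+i<j))) (proj₁ (born (suc i) (<⇒≤ 1+i<j))))
    (~-sym (link (suc i) 1+i<j))
    (uninfected-mono (n≤1+n i) (proj₂ (born (suc (suc i)) 1+i<j)))
    where open Chain C

  -- An interior chain vertex has a single neighbour not infected one step earlier, so two chains
  -- that meet stay together from then on.
  chains-agree-upward : (∀ v → degree G v ≤ 3) → ∀ {j k v w} (C : Chain j v) (D : Chain k w) →
    ∀ {i T} → suc i ≤ T → T ≤ j → T ≤ k →
    Chain.vertex C (suc i) ≡ Chain.vertex D (suc i) → Chain.vertex C T ≡ Chain.vertex D T
  chains-agree-upward Δ≤3 {j} {k} C D {i} 1+i≤T T≤j T≤k meet = go (≤⇒≤′ 1+i≤T) T≤j T≤k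
    where
    open Chain
    go : ∀ {T} → suc i ≤′ T → T ≤ j → T ≤ k → vertex C T ≡ vertex D T
    go ≤′-refl _ _ = meet
    go {suc zero} (≤′-step (≤′-reflexive ()))
    go {suc (suc T)} (≤′-step 1+i≤′T) 2+T≤j 2+T≤k with
      proj₁ (chain-interior Δ≤3 C T 2+T≤j)
        (subst (_~ vertex D (suc (suc T))) (sym (go 1+i≤′T (<⇒≤ 2+T≤j) (<⇒≤ 2+T≤k))) (~-sym (link D (suc T) 2+T≤k)))
    ... | inj₁ agree = sym agree
    ... | inj₂ infected = ⊥-elim (true≢false infected (uninfected-mono (n≤1+n T) (proj₂ (born D (suc (suc T)) 2+T≤k))))

  -- The path c 1, …, c (1 + ρ), d s, …, d 1 formed by two infection chains whose tops v and w
  -- are adjacent (or just c 1, …, c (1 + ρ) when s = 0).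
  module JoinedChains (Δ≤3 : ∀ v → degree G v ≤ 3) {ρ s v w} (C : Chain (suc ρ) v) (D : Chain s w)
    (s≤1+ρ : s ≤ suc ρ)
    (top-link : 0 < s → v ~ w)
    (v-nbrs : ∀ {z} → v ~ z → (0 < s × z ≡ w) ⊎ Infected ρ z)
    (w-nbrs : 0 < s → ∀ {z} → w ~ z → z ≡ v ⊎ Infected (pred s) z)
    (tops-differ : 0 < s → Chain.vertex C s ≢ w)
    where

    open Chain C using () renaming (vertex to c)
    open Chain D using () renaming (vertex to d)

    M : ℕ
    M = ρ + s

    q : ℕ → V
    q a with a ≤? ρ
    ... | yes _ = c (suc a)
    ... | no _ = d (suc (M ∸ a))

    level : ℕ → ℕ
    level a with a ≤? ρ
    ... | yes _ = a
    ... | no _ = M ∸ a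

    right⇒ρ<a : ∀ {a j} → a + j ≡ M → j < s → ρ < a
    right⇒ρ<a eq j<s = ≰⇒> (λ a≤ρ → <-irrefl eq (+-mono-≤-< a≤ρ j<s))

    M∸a : ∀ {a j} → a + j ≡ M → M ∸ a ≡ j
    M∸a {a} {j} eq = trans (cong (_∸ a) (sym eq)) (m+n∸m≡n a j)

    q-left : ∀ {a} → a ≤ ρ → q a ≡ c (suc a)
    q-left {a} a≤ρ with a ≤? ρ
    ... | yes _ = refl
    ... | no a≰ρ = ⊥-elim (a≰ρ a≤ρ)

    level-left : ∀ {a} → a ≤ ρ → level a ≡ a
    level-left {a} a≤ρ with a ≤? ρ
    ... | yes _ = refl
    ... | no a≰ρ = ⊥-elim (a≰ρ a≤ρ)

    q-right : ∀ {a j} → a + j ≡ M → j < s → q a ≡ d (suc j)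
    q-right {a} eq j<s with a ≤? ρ
    ... | yes a≤ρ = ⊥-elim (<⇒≱ (right⇒ρ<a eq j<s) a≤ρ)
    ... | no _ = cong (λ x → d (suc x)) (M∸a eq)

    level-right : ∀ {a j} → a + j ≡ M → j < s → level a ≡ j
    level-right {a} eq j<s with a ≤? ρ
    ... | yes a≤ρ = ⊥-elim (<⇒≱ (right⇒ρ<a eq j<s) a≤ρ)
    ... | no _ = M∸a eq

    data Side (a : ℕ) : Set where
      left  : a ≤ ρ → Side a
      right : ∀ j → a + j ≡ M → j < s → Side a

    side : ∀ {a} → a ≤ M → Side a
    side {a} a≤M with a ≤? ρ
    ... | yes a≤ρ = left a≤ρ
    ... | no a≰ρ = right (M ∸ a) (m+[n∸m]≡n a≤M)
          (+-cancelˡ-< ρ _ _ (<-≤-trans (+-monoˡ-< (M ∸ a) (≰⇒> a≰ρ)) (≤-reflexive (m+[n∸m]≡n a≤M))))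

    q-junction-left : q ρ ≡ v
    q-junction-left = trans (q-left ≤-refl) (Chain.top C)

    q-junction-right : 0 < s → q (suc ρ) ≡ w
    q-junction-right 0<s = trans (q-right junction (≤-reflexive 1+pred[s])) (trans (cong d 1+pred[s]) (Chain.top D))
      where
      1+pred[s] : suc (pred s) ≡ s
      1+pred[s] = suc-pred s ⦃ >-nonZero 0<s ⦄
      junction : suc ρ + pred s ≡ M
      junction = trans (sym (+-suc ρ (pred s))) (cong (ρ +_) 1+pred[s])

    c-born : ∀ {i} → i ≤ ρ → BornAt (suc i) (c (suc i))
    c-born i≤ρ = Chain.born C _ (s≤s i≤ρ)

    d-born : ∀ {j} → j < s → BornAt (suc j) (d (suc j))
    d-born j<s = Chain.born D _ j<s

    disjoint : ∀ {i j} → i ≤ ρ → j < s → c (suc i) ≢ d (suc j)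
    disjoint {i} {j} i≤ρ j<s c≡d
      with born-unique (suc i) (suc j) (c-born i≤ρ) (subst (BornAt (suc j)) (sym c≡d) (d-born j<s))
    ... | refl = tops-differ (m<n⇒0<n j<s) (trans (chains-agree-upward Δ≤3 C D j<s s≤1+ρ ≤-refl c≡d) (Chain.top D))

    q-uninfected : ∀ {a} → a ≤ M → Uninfected (level a) (q a)
    q-uninfected a≤M with side a≤M
    ... | left a≤ρ = subst₂ Uninfected (sym (level-left a≤ρ)) (sym (q-left a≤ρ)) (proj₂ (c-born a≤ρ))
    ... | right j eq j<s = subst₂ Uninfected (sym (level-right eq j<s)) (sym (q-right eq j<s)) (proj₂ (d-born j<s))

    ρ<M⇒0<s : ρ < M → 0 < s
    ρ<M⇒0<s ρ<M = +-cancelˡ-< ρ 0 s (subst (_< M) (sym (+-identityʳ ρ)) ρ<M)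

    left-step : ∀ {a} → a < M → a ≤ ρ → q a ~ q (suc a)
    left-step {a} a<M a≤ρ with m≤n⇒m<n∨m≡n a≤ρ
    ... | inj₁ a<ρ = subst₂ _~_ (sym (q-left a≤ρ)) (sym (q-left a<ρ)) (~-sym (Chain.link C (suc a) (s≤s a<ρ)))
    ... | inj₂ refl = subst₂ _~_ (sym q-junction-left) (sym (q-junction-right 0<s)) (top-link 0<s)
      where
      0<s : 0 < s
      0<s = ρ<M⇒0<s a<M

    q-step : ∀ {a} → a < M → q a ~ q (suc a)
    q-step {a} a<M with side (<⇒≤ a<M)
    ... | left a≤ρ = left-step a<M a≤ρ
    ... | right zero eq _ = ⊥-elim (<-irrefl (trans (sym (+-identityʳ a)) eq) a<M)
    ... | right (suc j) eq 1+j<s =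
      subst₂ _~_ (sym (q-right eq 1+j<s)) (sym (q-right (trans (sym (+-suc a j)) eq) (<-trans (n<1+n j) 1+j<s)))
        (Chain.link D (suc j) 1+j<s)

    q-consecutive : ∀ {a b} → a ≤ M → b ≤ M → Consecutive a b → q a ~ q b
    q-consecutive _ b≤M (inj₁ refl) = q-step b≤M
    q-consecutive a≤M _ (inj₂ refl) = ~-sym (q-step a≤M)

    OnPathNextTo : ℕ → V → Set
    OnPathNextTo a z = ∃ λ b → b ≤ M × Consecutive a b × z ≡ q b

    left-nbrs : ∀ {a z} → a ≤ ρ → c (suc a) ~ z → OnPathNextTo a z ⊎ Infected a z
    left-nbrs a≤ρ c~z with m≤n⇒m<n∨m≡n a≤ρ
    left-nbrs {a} a≤ρ c~z | inj₁ a<ρ with proj₁ (chain-interior Δ≤3 C a (s≤s a<ρ)) c~z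
    ... | inj₁ z≡c = inj₁ (suc a , ≤-trans a<ρ (m≤m+n ρ s) , inj₁ refl , trans z≡c (sym (q-left a<ρ)))
    ... | inj₂ iz = inj₂ iz
    left-nbrs a≤ρ c~z | inj₂ refl with v-nbrs (subst (_~ _) (Chain.top C) c~z)
    ... | inj₁ (0<s , z≡w) = inj₁ (suc ρ , m<m+n ρ 0<s , inj₁ refl , trans z≡w (sym (q-junction-right 0<s)))
    ... | inj₂ iz = inj₂ iz

    right-end : ∀ {a j} → a + j ≡ M → suc j ≡ s → a ≡ suc ρ
    right-end {a} {j} eq 1+j≡s = +-cancelʳ-≡ j a (suc ρ) (trans eq (trans (cong (ρ +_) (sym 1+j≡s)) (+-suc ρ j)))

    right-nbrs : ∀ {a j z} → a + j ≡ M → j < s → d (suc j) ~ z → OnPathNextTo a z ⊎ Infected j z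
    right-nbrs {zero} eq j<s _ = ⊥-elim (<⇒≱ (right⇒ρ<a eq j<s) z≤n)
    right-nbrs {suc b} eq j<s d~z with m≤n⇒m<n∨m≡n j<s
    right-nbrs {suc b} {j} eq j<s d~z | inj₁ 1+j<s with proj₁ (chain-interior Δ≤3 D j 1+j<s) d~z
    ... | inj₁ z≡d = inj₁ (b , b≤M , inj₂ refl , trans z≡d (sym (q-right (trans (+-suc b j) eq) 1+j<s)))
      where
      b≤M : b ≤ M
      b≤M = ≤-trans (n≤1+n b) (subst (suc b ≤_) eq (m≤m+n (suc b) j))
    ... | inj₂ iz = inj₂ iz
    right-nbrs {suc b} eq j<s d~z | inj₂ 1+j≡s
      with w-nbrs (m<n⇒0<n j<s) (subst (_~ _) (trans (cong d 1+j≡s) (Chain.top D)) d~z)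
    ... | inj₁ z≡v = inj₁ (ρ , m≤m+n ρ s , inj₂ (sym (right-end eq 1+j≡s)) , trans z≡v (sym q-junction-left))
    ... | inj₂ iz = inj₂ (subst (λ t → Infected t _) (cong pred (sym 1+j≡s)) iz)

    q-nbrs : ∀ {a z} → a ≤ M → q a ~ z → OnPathNextTo a z ⊎ Infected (level a) z
    q-nbrs a≤M qa~z with side a≤M
    ... | left a≤ρ = map₂ (subst (λ t → Infected t _) (sym (level-left a≤ρ)))
                       (left-nbrs a≤ρ (subst (_~ _) (q-left a≤ρ) qa~z))
    ... | right j eq j<s = map₂ (subst (λ t → Infected t _) (sym (level-right eq j<s)))
                             (right-nbrs eq j<s (subst (_~ _) (q-right eq j<s) qa~z))

    q-injective : ∀ {a b} → a ≤ M → b ≤ M → q a ≡ q b → a ≡ b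
    q-injective {a} {b} a≤M b≤M qa≡qb with side a≤M | side b≤M
    ... | left a≤ρ | left b≤ρ = suc-injective (born-unique (suc a) (suc b) (c-born a≤ρ)
          (subst (BornAt (suc b)) (trans (sym (q-left b≤ρ)) (trans (sym qa≡qb) (q-left a≤ρ))) (c-born b≤ρ)))
    ... | left a≤ρ | right j eq j<s = ⊥-elim (disjoint a≤ρ j<s (trans (sym (q-left a≤ρ)) (trans qa≡qb (q-right eq j<s))))
    ... | right j eq j<s | left b≤ρ = ⊥-elim (disjoint b≤ρ j<s (trans (sym (q-left b≤ρ)) (trans (sym qa≡qb) (q-right eq j<s))))
    ... | right j eqa j<s | right j′ eqb j′<s
      with born-unique (suc j) (suc j′) (d-born j<s)
             (subst (BornAt (suc j′)) (trans (sym (q-right eqb j′<s)) (trans (sym qa≡qb) (q-right eqa j<s))) (d-born j′<s))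
    ... | refl = +-cancelʳ-≡ j a b (trans eqa (sym eqb))

    path-induced : IsInducedPath G M (λ i → q (toℕ i))
    path-induced = levelled-path-induced M q level q-uninfected q-consecutive q-nbrs q-injective

    bound : (i : Fin (suc M)) → toℕ i ≤ M
    bound i = ≤-pred (toℕ<n i)

    interior-degree : ∀ {a} → a ≤ M → a ≢ ρ → a ≢ suc ρ → degree G (q a) ≡ 3
    interior-degree a≤M a≢ρ a≢1+ρ with side a≤M
    ... | left a≤ρ = trans (cong (degree G) (q-left a≤ρ)) (proj₂ (chain-interior Δ≤3 C _ (s≤s (≤∧≢⇒< a≤ρ a≢ρ))))
    ... | right j eq j<s with m≤n⇒m<n∨m≡n j<s
    ...   | inj₁ 1+j<s = trans (cong (degree G) (q-right eq j<s)) (proj₂ (chain-interior Δ≤3 D j 1+j<s))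
    ...   | inj₂ 1+j≡s = ⊥-elim (a≢1+ρ (right-end eq 1+j≡s))

    path-all-degree-3 : degree G v ≡ 3 → (0 < s → degree G w ≡ 3) → AllDeg3 G M (λ i → q (toℕ i))
    path-all-degree-3 dv dw i with toℕ i ≟ ρ | toℕ i ≟ suc ρ
    ... | yes a≡ρ | _ = trans (cong (degree G) (trans (cong q a≡ρ) q-junction-left)) dv
    ... | no _ | yes a≡1+ρ = trans (cong (degree G) (trans (cong q a≡1+ρ) (q-junction-right 0<s))) (dw 0<s)
      where
      0<s : 0 < s
      0<s = ρ<M⇒0<s (subst (_≤ M) a≡1+ρ (bound i))
    ... | no a≢ρ | no a≢1+ρ = interior-degree (bound i) a≢ρ a≢1+ρ

    path-one-end-degree-2 : s ≡ 0 → degree G v ≡ 2 → OneEndDeg2 G M (λ i → q (toℕ i))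
    path-one-end-degree-2 s≡0 dv = inj₂ (trans (cong (degree G) (trans (cong q end≡ρ) q-junction-left)) dv , others)
      where
      M≡ρ : M ≡ ρ
      M≡ρ = trans (cong (ρ +_) s≡0) (+-identityʳ ρ)
      end≡ρ : toℕ (fromℕ M) ≡ ρ
      end≡ρ = trans (toℕ-fromℕ M) M≡ρ
      others : ∀ i → i ≢ fromℕ M → degree G (q (toℕ i)) ≡ 3
      others i i≢end = interior-degree (bound i) (λ a≡ρ → i≢end (toℕ-injective (trans a≡ρ (sym end≡ρ))))
        (λ a≡1+ρ → 1+n≰n (subst (_≤ ρ) a≡1+ρ (subst (toℕ i ≤_) M≡ρ (bound i))))

-- Slow percolation yields a long induced path

module Forward (G : Graph) (Δ≤3 : ∀ v → degree G v ≤ 3) (S : VSet G) where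
  open Percolation G S

  ForcedPath : ℕ → Set
  ForcedPath τ = InducedPathWith G (AllDeg3 G) (τ + τ) ⊎ InducedPathWith G (OneEndDeg2 G) τ

  module FinalInfection (σ : ℕ) (full : ∀ u → Infected (suc (suc σ)) u) {v} (v-late : Uninfected (suc σ) v) where

    τ : ℕ
    τ = suc σ

    C : Chain (suc τ) v
    C = chain (suc τ) (full v , v-late)

    open Chain C using () renaming (vertex to c)

    2≤nbrs : 2 ≤ nbrsIn G (iter G S τ) v
    2≤nbrs = newly-infected⇒2≤nbrs {τ} v-late (full v)

    via-late-neighbour : ∀ {z} → v ~ z → Uninfected τ z → ForcedPath τ
    via-late-neighbour {z} v~z z-late =
      inj₁ (M , _ , path-induced , path-all-degree-3 (proj₂ v-side) (λ _ → proj₂ z-side) , +-monoʳ-≤ τ (n≤1+n τ))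
      where
      v-side : (∀ {y} → v ~ y → y ≡ z ⊎ Infected τ y) × degree G v ≡ 3
      v-side = birth-next-to-uninfected {τ} (Δ≤3 v) 2≤nbrs v~z z-late
      z-side : (∀ {y} → z ~ y → y ≡ v ⊎ Infected τ y) × degree G z ≡ 3
      z-side = birth-next-to-uninfected {τ} (Δ≤3 z) (newly-infected⇒2≤nbrs {τ} z-late (full z)) (~-sym v~z) v-late
      open JoinedChains Δ≤3 C (chain (suc τ) (full z , z-late)) ≤-refl (λ _ → v~z)
        (λ v~y → map₁ (s≤s z≤n ,_) (proj₁ v-side v~y)) (λ _ → proj₁ z-side)
        (λ _ c≡z → ~-irrefl (subst (v ~_) (sym (trans (sym (Chain.top C)) c≡z)) v~z))

    via-degree-2 : (∀ {y} → v ~ y → Infected τ y) → degree G v ≡ 2 → ForcedPath τ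
    via-degree-2 early dv = inj₂ (M , _ , path-induced , path-one-end-degree-2 refl dv , m≤m+n τ 0)
      where
      open JoinedChains Δ≤3 C (chain 0 (Chain.born C 0 z≤n)) z≤n (λ ()) (λ v~y → inj₂ (early v~y)) (λ ()) (λ ())

    -- Otherwise v would have at most two neighbours.
    second-late-neighbour : degree G v ≡ 3 → ∃ λ u → v ~ u × u ≢ c τ × Uninfected σ u
    second-late-neighbour dv with any? (λ u → (adj G v u ≟ᵇ true) ×-dec ¬? (u ≟ᶠ c τ) ×-dec (iter G S σ u ≟ᵇ false))
    ... | yes found = found
    ... | no none = ⊥-elim (<⇒≱ (≤-reflexive (sym dv)) degree≤2)
      where
      v~cτ : v ~ c τ
      v~cτ = subst (_~ c τ) (Chain.top C) (Chain.link C τ ≤-refl)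
      others : ∀ u → erase (adj G v) (c τ) u ≡ true → adj G v u ∧ iter G S σ u ≡ true
      others u e with erase-true⁻ (adj G v) e | iter G S σ u ≟ᵇ true
      ... | v~u , _ | yes iu = ∧-true v~u iu
      ... | v~u , u≢cτ | no ¬iu = ⊥-elim (none (u , v~u , u≢cτ , ¬-not ¬iu))
      degree≤2 : degree G v ≤ 2
      degree≤2 = begin
        degree G v                                          ≡⟨ countTrue-erase (adj G v) (c τ) ⟩
        bit (adj G v (c τ)) + countTrue (erase (adj G v) (c τ)) ≡⟨ cong (λ b → bit b + countTrue (erase (adj G v) (c τ))) v~cτ ⟩
        suc (countTrue (erase (adj G v) (c τ)))             ≤⟨ s≤s (≤-trans (countTrue-mono others) (uninfected⇒nbrs≤1 {σ} v-late)) ⟩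
        2                                                   ∎
        where open ≤-Reasoning

    via-degree-3 : (∀ {y} → v ~ y → Infected τ y) → degree G v ≡ 3 → ForcedPath τ
    via-degree-3 early dv with second-late-neighbour dv
    ... | u , v~u , u≢cτ , u-late = inj₁ (M , _ , path-induced , path-all-degree-3 dv (λ _ → proj₂ u-side) , ≤-refl)
      where
      u-side : (∀ {y} → u ~ y → y ≡ v ⊎ Infected σ y) × degree G u ≡ 3
      u-side = birth-next-to-uninfected {σ} (Δ≤3 u) (newly-infected⇒2≤nbrs {σ} u-late (early v~u)) (~-sym v~u)
                 (uninfected-mono (n≤1+n σ) v-late)
      open JoinedChains Δ≤3 C (chain τ (early v~u , u-late)) (n≤1+n τ) (λ _ → v~u) (λ v~y → inj₂ (early v~y))
        (λ _ → proj₁ u-side) (λ _ c≡u → u≢cτ (sym c≡u))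

    early-from : ¬ (∃ λ z → v ~ z × Uninfected τ z) → ∀ {y} → v ~ y → Infected τ y
    early-from none {y} v~y with iter G S τ y ≟ᵇ true
    ... | yes iy = iy
    ... | no ¬iy = ⊥-elim (none (y , v~y , ¬-not ¬iy))

    forced-path : ForcedPath τ
    forced-path with any? (λ z → (adj G v z ≟ᵇ true) ×-dec (iter G S τ z ≟ᵇ false))
    ... | yes (z , v~z , z-late) = via-late-neighbour v~z z-late
    ... | no none with degree G v ≟ 2
    ...   | yes dv = via-degree-2 (early-from none) dv
    ...   | no dv≢2 = via-degree-3 (early-from none) (≤-antisym (Δ≤3 v) (≤∧≢⇒< 2≤degree (λ 2≡d → dv≢2 (sym 2≡d))))
      where
      2≤degree : 2 ≤ degree G v
      2≤degree = ≤-trans 2≤nbrs (countTrue-mono (λ w e → proj₁ (∧-true⁻ {adj G v w} e)))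

slow⇒long-path : (G : Graph) → MaxDegree3 G → ∀ k → PercTimeAtLeast G k → LongInducedPath G k
slow⇒long-path G (Δ≤3 , v , dv) k (S , t , (full , early) , k≤t) with k ≤? 1
... | yes k≤1 = 0 , (λ _ → v) , single-vertex-induced {G} {v} , inj₁ ((λ _ → dv) , short k k≤1)
  where
  short : ∀ k → k ≤ 1 → 2 * k ∸ 2 ≤ 0
  short zero _ = z≤n
  short (suc zero) _ = z≤n
  short (suc (suc k)) (s≤s ())
... | no k≰1 = from-time t full early k≤t
  where
  open Percolation G S
  open Forward G Δ≤3 S
  from-time : ∀ t → Full G (iter G S t) → (∀ t′ → t′ < t → ¬ Full G (iter G S t′)) → k ≤ t → LongInducedPath G k
  from-time (suc (suc σ)) full early k≤t
    with ¬∀⟶∃¬ (n G) _ (λ v → iter G S (suc σ) v ≟ᵇ true) (early (suc σ) ≤-refl)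
  ... | v , ¬iv with FinalInfection.forced-path σ full (¬-not ¬iv)
  ... | inj₁ (m , p , induced , deg3 , τ+τ≤m) = m , p , induced , inj₁ (deg3 , ≤-trans doubled τ+τ≤m)
    where
    doubled : 2 * k ∸ 2 ≤ suc σ + suc σ
    doubled = subst (_≤ suc σ + suc σ) (sym (2*n∸2≡pred[n]+pred[n] k)) (+-mono-≤ (pred-mono-≤ k≤t) (pred-mono-≤ k≤t))
  ... | inj₂ (m , p , induced , end , τ≤m) =
    m , p , induced , inj₂ (end , ≤-trans (subst (_≤ suc σ) (sym (n∸1≡pred[n] k)) (pred-mono-≤ k≤t)) τ≤m)
  from-time zero _ _ k≤0 = ⊥-elim (k≰1 (≤-trans k≤0 z≤n))
  from-time (suc zero) _ _ k≤1 = ⊥-elim (k≰1 k≤1)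

-- A long induced path yields slow percolation

module Backward (G : Graph) {m} (p : Fin (suc m) → Fin (n G)) (p-induced : IsInducedPath G m p) where

  on-path? : (v : Fin (n G)) → Dec (∃ λ i → v ≡ p i)
  on-path? v = any? (λ i → v ≟ᶠ p i)

  S : VSet G
  S v = not (does (on-path? v))

  open Percolation G S

  -- junk value p zero beyond the end of the path
  at : ℕ → V
  at a with a <? suc m
  ... | yes a<1+m = p (fromℕ< a<1+m)
  ... | no _ = p zero

  index : ∀ {a} → a ≤ m → ∃ λ i → toℕ i ≡ a × at a ≡ p i
  index {a} a≤m with a <? suc m
  ... | yes a<1+m = fromℕ< a<1+m , toℕ-fromℕ< a<1+m , refl
  ... | no a≮1+m = ⊥-elim (a≮1+m (s≤s a≤m))

  at-toℕ : ∀ i → at (toℕ i) ≡ p i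
  at-toℕ i with toℕ i <? suc m
  ... | yes i<1+m = cong p (fromℕ<-toℕ i i<1+m)
  ... | no i≮1+m = ⊥-elim (i≮1+m (toℕ<n i))

  at-adjacent : ∀ {a b} → a ≤ m → b ≤ m → at a ~ at b → Consecutive a b
  at-adjacent a≤m b≤m a~b with index a≤m | index b≤m
  ... | i , refl , ai | j , refl , bj = Equivalence.to (proj₂ p-induced i j) (subst₂ _~_ ai bj a~b)

  at-consecutive : ∀ {a b} → a ≤ m → b ≤ m → Consecutive a b → at a ~ at b
  at-consecutive a≤m b≤m a⋯b with index a≤m | index b≤m
  ... | i , refl , ai | j , refl , bj = subst₂ _~_ (sym ai) (sym bj) (Equivalence.from (proj₂ p-induced i j) a⋯b)

  at-injective : ∀ {a b} → a ≤ m → b ≤ m → at a ≡ at b → a ≡ b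
  at-injective a≤m b≤m e with index a≤m | index b≤m
  ... | i , refl , ai | j , refl , bj = cong toℕ (proj₁ p-induced (trans (sym ai) (trans e bj)))

  at-off : ∀ {a} → a ≤ m → S (at a) ≡ false
  at-off {a} a≤m = cong not (dec-true (on-path? (at a)) (proj₁ (index a≤m) , proj₂ (proj₂ (index a≤m))))

  off⇒on-path : ∀ {v} → S v ≡ false → ∃ λ a → a ≤ m × v ≡ at a
  off⇒on-path {v} = on-path (on-path? v)
    where
    on-path : (d : Dec (∃ λ i → v ≡ p i)) → not (does d) ≡ false → ∃ λ a → a ≤ m × v ≡ at a
    on-path (yes (i , v≡pi)) _ = toℕ i , ≤-pred (toℕ<n i) , trans v≡pi (sym (at-toℕ i))
    on-path (no _) ()

  off-nbr : ∀ {a z} → a ≤ m → at a ~ z → S z ≡ false → ∃ λ b → b ≤ m × Consecutive a b × z ≡ at b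
  off-nbr a≤m a~z z-off with off⇒on-path z-off
  ... | b , b≤m , refl = b , b≤m , at-adjacent a≤m b≤m a~z , refl

  data Position (a : ℕ) : Set where
    only  : a ≡ 0 → m ≡ 0 → Position a
    first : a ≡ 0 → 0 < m → Position a
    inner : ∀ b → a ≡ suc b → suc b < m → Position a
    last  : ∀ b → a ≡ suc b → suc b ≡ m → Position a

  position : ∀ {a} → a ≤ m → Position a
  position {zero} _ with m ≟ 0
  ... | yes m≡0 = only refl m≡0
  ... | no m≢0 = first refl (n≢0⇒n>0 m≢0)
  position {suc b} 1+b≤m with m≤n⇒m<n∨m≡n 1+b≤m
  ... | inj₁ 1+b<m = inner b refl 1+b<m
  ... | inj₂ 1+b≡m = last b refl 1+b≡m

  position-≤ : ∀ {a} → Position a → a ≤ m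
  position-≤ (only refl _) = z≤n
  position-≤ (first refl _) = z≤n
  position-≤ (inner b refl 1+b<m) = <⇒≤ 1+b<m
  position-≤ (last b refl 1+b≡m) = ≤-reflexive 1+b≡m

  pathNbrs : ∀ {a} → Position a → List V
  pathNbrs (only _ _) = []
  pathNbrs (first _ _) = at 1 ∷ []
  pathNbrs (inner b _ _) = at b ∷ at (suc (suc b)) ∷ []
  pathNbrs (last b _ _) = at b ∷ []

  pathNbrs-complete : ∀ {a b z} (pos : Position a) → b ≤ m → Consecutive a b → z ≡ at b → z ∈ pathNbrs pos
  pathNbrs-complete (only refl m≡0) b≤m (inj₁ refl) _ = ⊥-elim (1+n≰n (subst (1 ≤_) m≡0 b≤m))
  pathNbrs-complete (only refl _) _ (inj₂ ()) _
  pathNbrs-complete (first refl _) _ (inj₁ refl) z≡ = here z≡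
  pathNbrs-complete (first refl _) _ (inj₂ ()) _
  pathNbrs-complete (inner b refl _) _ (inj₁ refl) z≡ = there (here z≡)
  pathNbrs-complete (inner b refl _) _ (inj₂ refl) z≡ = here z≡
  pathNbrs-complete (last b refl 1+b≡m) b≤m (inj₁ refl) _ = ⊥-elim (1+n≰n (subst (suc (suc b) ≤_) (sym 1+b≡m) b≤m))
  pathNbrs-complete (last b refl _) _ (inj₂ refl) z≡ = here z≡

  path-nbr? : ℕ → V → Bool
  path-nbr? a x = adj G (at a) x ∧ not (S x)

  PathNbr : ℕ → V → Set
  PathNbr a x = path-nbr? a x ≡ true

  path-nbr : ∀ {a b} → a ≤ m → b ≤ m → Consecutive a b → PathNbr a (at b)
  path-nbr {a} {b} a≤m b≤m a⋯b =
    subst (λ s → adj G (at a) (at b) ∧ not s ≡ true) (sym (at-off b≤m)) (∧-true (at-consecutive a≤m b≤m a⋯b) refl)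

  pathNbrs-sound : ∀ {a} (pos : Position a) → All (PathNbr a) (pathNbrs pos)
  pathNbrs-sound (only _ _) = []
  pathNbrs-sound (first refl 0<m) = path-nbr z≤n 0<m (inj₁ refl) ∷ []
  pathNbrs-sound (inner b refl 1+b<m) =
    path-nbr (<⇒≤ 1+b<m) (≤-trans (n≤1+n b) (<⇒≤ 1+b<m)) (inj₂ refl) ∷
    path-nbr (<⇒≤ 1+b<m) 1+b<m (inj₁ refl) ∷ []
  pathNbrs-sound (last b refl 1+b≡m) =
    path-nbr (≤-reflexive 1+b≡m) (≤-trans (n≤1+n b) (≤-reflexive 1+b≡m)) (inj₂ refl) ∷ []

  pathNbrs-distinct : ∀ {a} (pos : Position a) → AllPairs _≢_ (pathNbrs pos)
  pathNbrs-distinct (only _ _) = []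
  pathNbrs-distinct (first _ _) = [] ∷ []
  pathNbrs-distinct (inner b refl 1+b<m) =
    ((λ e → <-irrefl (at-injective (≤-trans (n≤1+n b) (<⇒≤ 1+b<m)) 1+b<m e) (m<n⇒m<1+n (n<1+n b))) ∷ []) ∷ [] ∷ []
  pathNbrs-distinct (last _ _ _) = [] ∷ []

  path-degree : ∀ {a} (pos : Position a) → countTrue (path-nbr? a) ≡ length (pathNbrs pos)
  path-degree {a} pos = ≤-antisym
    (countTrue≤length _ _ (λ w e → let a~w , w-off = ∧-true⁻ {adj G (at a) w} e in
       let b , b≤m , a⋯b , w≡ = off-nbr (position-≤ pos) a~w (not-true⁻ w-off) in pathNbrs-complete pos b≤m a⋯b w≡))
    (length≤countTrue _ (pathNbrs-distinct pos) (pathNbrs-sound pos))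

  outside-count : ∀ {a} (pos : Position a) → nbrsIn G S (at a) ≡ degree G (at a) ∸ length (pathNbrs pos)
  outside-count {a} pos = begin
    nbrsIn G S (at a)                              ≡⟨ m+n∸n≡m _ ℓ ⟨
    nbrsIn G S (at a) + ℓ ∸ ℓ                      ≡⟨ cong (λ c → nbrsIn G S (at a) + c ∸ ℓ) (path-degree pos) ⟨
    nbrsIn G S (at a) + countTrue (path-nbr? a) ∸ ℓ ≡⟨ cong (_∸ ℓ) (countTrue-split (adj G (at a)) S) ⟨
    degree G (at a) ∸ ℓ                            ∎
    where
    open ≡-Reasoning
    ℓ : ℕ
    ℓ = length (pathNbrs pos)

  infected-in-order : 2 ≤ nbrsIn G S (at 0) → (∀ {a} → 0 < a → a ≤ m → 0 < nbrsIn G S (at a)) →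
    ∀ {a} → a ≤ m → Infected (suc a) (at a)
  infected-in-order two-at-0 some-after-0 {zero} _ with countTrue-two _ two-at-0
  ... | x , y , x≢y , ex , ey = infected-by-two {0} x≢y
        (proj₁ (∧-true⁻ {adj G (at 0) x} ex)) (proj₁ (∧-true⁻ {adj G (at 0) y} ey))
        (proj₂ (∧-true⁻ {adj G (at 0) x} ex)) (proj₂ (∧-true⁻ {adj G (at 0) y} ey))
  infected-in-order two-at-0 some-after-0 {suc a} 1+a≤m with fresh-true _ [] (some-after-0 (s≤s z≤n) 1+a≤m)
  ... | x , ex , _ with ∧-true⁻ {adj G (at (suc a)) x} ex
  ... | a~x , sx = infected-by-two {suc a} x≢at-a a~x (at-consecutive 1+a≤m a≤m (inj₂ refl))
                       (infected-mono {0} {suc a} z≤n sx) (infected-in-order two-at-0 some-after-0 a≤m)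
    where
    a≤m : a ≤ m
    a≤m = ≤-trans (n≤1+n a) 1+a≤m
    x≢at-a : x ≢ at a
    x≢at-a refl = true≢false sx (at-off a≤m)

  percolates : 2 ≤ nbrsIn G S (at 0) → (∀ {a} → 0 < a → a ≤ m → 0 < nbrsIn G S (at a)) → Full G (iter G S (suc m))
  percolates two-at-0 some-after-0 v with S v ≟ᵇ true
  ... | yes sv = infected-mono {0} {suc m} z≤n sv
  ... | no ¬sv with off⇒on-path (¬-not ¬sv)
  ... | a , a≤m , refl = infected-mono (s≤s a≤m) (infected-in-order two-at-0 some-after-0 a≤m)

  Lonely : ℕ → ℕ → Set
  Lonely j a = ∀ {b} → b ≤ m → ∣ a - b ∣ < j → nbrsIn G S (at b) ≤ 1

  -- The path neighbours of a lonely vertex are still uninfected one step earlier, so at most its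
  -- single outside neighbour can be infected.
  uninfected-while-lonely : ∀ j {a} → a ≤ m → Lonely j a → Uninfected j (at a)
  uninfected-while-lonely zero a≤m _ = at-off a≤m
  uninfected-while-lonely (suc j) {a} a≤m lonely =
    stays-uninfected {j} (uninfected-while-lonely j a≤m (λ b≤m d<j → lonely b≤m (m<n⇒m<1+n d<j)))
      (≤-trans (countTrue-mono infected⇒outside) (lonely a≤m (subst (_< suc j) (sym (∣n-n∣≡0 a)) (s≤s z≤n))))
    where
    nbr-uninfected : ∀ {b} → b ≤ m → Consecutive a b → Uninfected j (at b)
    nbr-uninfected {b} b≤m a⋯b = uninfected-while-lonely j b≤m (λ {c} c≤m d<j → lonely c≤m
      (≤-<-trans (∣-∣-triangle a b c) (subst (λ d → d + ∣ b - c ∣ < suc j) (sym (consecutive-distance a⋯b)) (s≤s d<j))))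
    infected⇒outside : ∀ w → adj G (at a) w ∧ iter G S j w ≡ true → adj G (at a) w ∧ S w ≡ true
    infected⇒outside w e with ∧-true⁻ {adj G (at a) w} e | S w ≟ᵇ true
    ... | a~w , _ | yes sw = ∧-true a~w sw
    ... | a~w , iw | no ¬sw with off-nbr a≤m a~w (¬-not ¬sw)
    ... | b , b≤m , a⋯b , refl = ⊥-elim (true≢false iw (nbr-uninfected b≤m a⋯b))

  slow-along-path : 2 ≤ nbrsIn G S (at 0) → (∀ {a} → 0 < a → a ≤ m → 0 < nbrsIn G S (at a)) →
    ∀ k {c} → c ≤ m → Lonely (pred k) c → PercTimeAtLeast G k
  slow-along-path two-at-0 some-after-0 k c≤m lonely =
    slow-percolation {suc m} k (percolates two-at-0 some-after-0) (_ , uninfected-while-lonely (pred k) c≤m lonely)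

  slow-if-all-degree-3 : AllDeg3 G m p → ∀ k → 2 * k ∸ 2 ≤ m → PercTimeAtLeast G k
  slow-if-all-degree-3 deg3 k bound = slow-along-path two-at-0 some-after-0 k k′≤m lonely
    where
    k′ : ℕ
    k′ = pred k
    k′+k′≤m : k′ + k′ ≤ m
    k′+k′≤m = subst (_≤ m) (2*n∸2≡pred[n]+pred[n] k) bound
    k′≤m : k′ ≤ m
    k′≤m = ≤-trans (m≤m+n k′ k′) k′+k′≤m
    outside : ∀ {a} (pos : Position a) → nbrsIn G S (at a) ≡ 3 ∸ length (pathNbrs pos)
    outside pos with index (position-≤ pos)
    ... | i , _ , e = trans (outside-count pos) (cong (_∸ length (pathNbrs pos)) (trans (cong (degree G) e) (deg3 i)))
    two-at-0 : 2 ≤ nbrsIn G S (at 0)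
    two-at-0 with position {0} z≤n
    ... | pos@(only _ _) = subst (2 ≤_) (sym (outside pos)) (s≤s (s≤s z≤n))
    ... | pos@(first _ _) = subst (2 ≤_) (sym (outside pos)) (s≤s (s≤s z≤n))
    ... | inner _ () _
    ... | last _ () _
    some-after-0 : ∀ {a} → 0 < a → a ≤ m → 0 < nbrsIn G S (at a)
    some-after-0 0<a a≤m with position a≤m
    ... | only a≡0 _ = ⊥-elim (<-irrefl (sym a≡0) 0<a)
    ... | first a≡0 _ = ⊥-elim (<-irrefl (sym a≡0) 0<a)
    ... | pos@(inner _ _ _) = subst (0 <_) (sym (outside pos)) (s≤s z≤n)
    ... | pos@(last _ _ _) = subst (0 <_) (sym (outside pos)) (s≤s z≤n)
    lonely : Lonely k′ k′
    lonely {b} b≤m d<k′ with b ≟ 0 | b ≟ m | position b≤m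
    ... | yes refl | _ | _ = ⊥-elim (<-irrefl (∣-∣-identityʳ k′) d<k′)
    ... | no _ | yes refl | _ = ⊥-elim (<⇒≱ (≤-<-trans (∣-∣-triangle 0 k′ m) (+-monoʳ-< k′ d<k′)) k′+k′≤m)
    ... | no b≢0 | no _ | only b≡0 _ = ⊥-elim (b≢0 b≡0)
    ... | no b≢0 | no _ | first b≡0 _ = ⊥-elim (b≢0 b≡0)
    ... | no _ | no _ | pos@(inner _ _ _) = ≤-reflexive (outside pos)
    ... | no _ | no b≢m | last _ b≡1+c 1+c≡m = ⊥-elim (b≢m (trans b≡1+c 1+c≡m))

  slow-if-degree-2-at-end : degree G (p (fromℕ m)) ≡ 2 → (∀ i → i ≢ fromℕ m → degree G (p i) ≡ 3) →
    ∀ k → k ∸ 1 ≤ m → PercTimeAtLeast G k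
  slow-if-degree-2-at-end end others k bound = slow-along-path two-at-0 some-after-0 k ≤-refl lonely
    where
    k′ : ℕ
    k′ = pred k
    k′≤m : k′ ≤ m
    k′≤m = subst (_≤ m) (n∸1≡pred[n] k) bound
    at-end : degree G (at m) ≡ 2
    at-end with index (≤-refl {m})
    ... | i , i≡m , e = trans (cong (degree G) (trans e (cong p (toℕ-injective (trans i≡m (sym (toℕ-fromℕ m))))))) end
    before-end : ∀ {a} → a < m → degree G (at a) ≡ 3
    before-end a<m with index (<⇒≤ a<m)
    ... | i , refl , e = trans (cong (degree G) e) (others i (λ { refl → <-irrefl (toℕ-fromℕ m) a<m }))
    two-at-0 : 2 ≤ nbrsIn G S (at 0)
    two-at-0 with position {0} z≤n
    ... | pos@(only _ m≡0) =
      ≤-reflexive (sym (trans (outside-count pos) (cong (_∸ 0) (subst (λ x → degree G (at x) ≡ 2) m≡0 at-end))))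
    ... | pos@(first _ 0<m) = ≤-reflexive (sym (trans (outside-count pos) (cong (_∸ 1) (before-end 0<m))))
    ... | inner _ () _
    ... | last _ () _
    one-outside-after-0 : ∀ {a} → 0 < a → a ≤ m → nbrsIn G S (at a) ≡ 1
    one-outside-after-0 0<a a≤m with position a≤m
    ... | only a≡0 _ = ⊥-elim (<-irrefl (sym a≡0) 0<a)
    ... | first a≡0 _ = ⊥-elim (<-irrefl (sym a≡0) 0<a)
    ... | pos@(inner b refl 1+b<m) = trans (outside-count pos) (cong (_∸ 2) (before-end 1+b<m))
    ... | pos@(last b refl 1+b≡m) =
      trans (outside-count pos) (cong (_∸ 1) (subst (λ x → degree G (at x) ≡ 2) (sym 1+b≡m) at-end))
    some-after-0 : ∀ {a} → 0 < a → a ≤ m → 0 < nbrsIn G S (at a)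
    some-after-0 0<a a≤m = ≤-reflexive (sym (one-outside-after-0 0<a a≤m))
    lonely : Lonely k′ m
    lonely {b} b≤m d<k′ with b ≟ 0
    ... | yes refl = ⊥-elim (<⇒≱ (subst (_< k′) (∣-∣-identityʳ m) d<k′) k′≤m)
    ... | no b≢0 = ≤-reflexive (one-outside-after-0 (n≢0⇒n>0 b≢0) b≤m)

long-path⇒slow : (G : Graph) → ∀ k → LongInducedPath G k → PercTimeAtLeast G k
long-path⇒slow G k (m , p , induced , inj₁ (deg3 , bound)) = Backward.slow-if-all-degree-3 G p induced deg3 k bound
long-path⇒slow G k (m , p , induced , inj₂ (inj₂ (end , others) , bound)) =
  Backward.slow-if-degree-2-at-end G p induced end others k bound
long-path⇒slow G k (m , p , induced , inj₂ (inj₁ start , bound)) with reverse-first-end {G} {m} {p} start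
... | end , others =
  Backward.slow-if-degree-2-at-end G (λ i → p (opposite i)) (reverse-induced {G} {m} {p} induced) end others k bound

lemma2 : (G : Graph) → Connected G → MaxDegree3 G → (k : ℕ) →
    PercTimeAtLeast G k ⇔
    (∃ λ m → ∃ λ (p : Fin (suc m) → Fin (n G)) → IsInducedPath G m p ×
      ((AllDeg3 G m p × 2 * k ∸ 2 ≤ m) ⊎ (OneEndDeg2 G m p × k ∸ 1 ≤ m)))
lemma2 G _ Δ k = mk⇔ (slow⇒long-path G Δ k) (long-path⇒slow G k)
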